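{- Let $\pi$ be a permutation of $[n]$ and $\bm{y}$ an almost optimal displacement vector of $\pi$. For $L,L'\in\mathcal{L}^1(\pi,\bm{y})$, $$\mathrm{opt}_{\mathit{CLL}}(L,L')\ \ge\ |\mathit{LT}(L)\,\triangle\,\mathit{LT}(L')|.$$
   Context: Let $[n]=\{1,\dots,n\}$ and $\pi$ a permutation of $[n]$. A cyclic ladder lottery $L$ of $\pi$ consists of $n$ vertical lines $1,\dots,n$ and finitely many horizontal bars at distinct heights. Each bar connects lines $k,k+1$ ($1\le k\le n-1$) or lines $n,1$. Start with element $i$ on top of line $i$ and sweep downward; each bar swaps the elements on its two lines. At the bottom, line $j$ must carry $\pi_j$. The route of $i$ is the pseudoline $\mathrm{pl}(L,i)$. On a cylinder, $L$ is an arrangement of $n$ $y$-monotone pseudolines whose intersections are the bars. Lotteries are identified as pseudoline arrangements. $\mathcal{L}^1(\pi)$ consists of lotteries in which any two pseudolines cross at most once. $\mathit{DV}(L)=(x_1,\dots,x_n)$, where $x_i$ is the number of bars at which $i$ moves one line right (line $k\to k+1$ or $n\to1$) minus the number at which it moves left. $\bm{y}$ is almost optimal if $\bm{y}=\mathit{DV}(L)$ for some $L\in\mathcal{L}^1(\pi)$, and $\mathcal{L}^1(\pi,\bm{y})=\{L\in\mathcal{L}^1(\pi):\mathit{DV}(L)=\bm{y}\}$. A triple $\{i,j,k\}$ is tangled if its three pseudolines pairwise cross. Restricting to them, let $p$ be the intersection adjacent to two top endpoints, $q$ the one adjacent to one top and one bottom endpoint, and $r$ the one adjacent to two bottom endpoints.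 The triple is left tangled if $p,q,r$ appear counterclockwise on the boundary of the enclosed region, and right tangled if clockwise. It is minimal if the enclosed region contains no part of another pseudoline. $\mathit{LT}(L)$ is the set of left tangled triples. A braid relation turns a minimal left tangled triple into a minimal right one or vice versa, passing one pseudoline across the intersection of the other two. Equivalently, it replaces consecutive bars on lines $(k,k+1),(k+1,k+2),(k,k+1)$ by $(k+1,k+2),(k,k+1),(k+1,k+2)$, indices mod $n$, or the reverse. $\mathrm{opt}_{\mathit{CLL}}(L,L')$ is the minimum number of braid relations needed to transform $L$ into $L'$. $\triangle$ denotes symmetric difference. -}

module Defs where

open import Data.Nat using (ℕ; zero; suc; _≤_; _<?_; s≤s)
open import Data.Integer using (ℤ; +_; _-_)
open import Data.Fin using (Fin; toℕ; fromℕ<; _≟_; _<_)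
import Data.Fin as F
open import Data.Fin.Permutation using (Permutation′; _⟨$⟩ʳ_)
open import Data.Bool using (Bool; true; false; _∧_; _∨_; not; _xor_; if_then_else_)
open import Data.List using (List; []; _∷_; _++_; length; filterᵇ; concatMap; foldl)
open import Data.List.Base using (allFin)
open import Data.Product using (_×_; _,_; ∃)
open import Relation.Binary.PropositionalEquality using (_≡_; _≢_)
open import Relation.Nullary.Decidable using (⌊_⌋; yes; no)

-- Lines and elements are both indexed by Fin n (0-based: line k of the
-- paper is Fin index k-1).  A bar is named by its left line k : Fin n;
-- it connects line k with line (next k), where next is k+1 mod n.
-- So the bar "n,1" of the paper is the bar at index n-1.

next : ∀ {n} → Fin n → Fin n
next {suc m} k with suc (toℕ k) <? suc m
... | yes p = fromℕ< p
... | no _ = F.zero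

-- A cyclic ladder lottery: its bars listed from top to bottom.
Lottery : ℕ → Set
Lottery n = List (Fin n)

-- A configuration: which element currently sits on each line.
Config : ℕ → Set
Config n = Fin n → Fin n

_==_ : ∀ {n} → Fin n → Fin n → Bool
a == b = ⌊ a ≟ b ⌋

applyBar : ∀ {n} → Fin n → Config n → Config n
applyBar k σ j =
  if j == k then σ (next k) else (if j == next k then σ k else σ j)

run : ∀ {n} → Lottery n → Config n
run L = foldl (λ σ k → applyBar k σ) (λ i → i) L

traceFrom : ∀ {n} → Config n → Lottery n → List (Config n × Fin n)
traceFrom σ [] = []
traceFrom σ (k ∷ L) = (σ , k) ∷ traceFrom (applyBar k σ) L

trace : ∀ {n} → Lottery n → List (Config n × Fin n)
trace L = traceFrom (λ i → i) L

movesRight : ∀ {n} → Config n × Fin n → Fin n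
movesRight (σ , k) = σ k

movesLeft : ∀ {n} → Config n × Fin n → Fin n
movesLeft (σ , k) = σ (next k)

indicator : Bool → ℤ
indicator true = + 1
indicator false = + 0

sumℤ : List ℤ → ℤ
sumℤ [] = + 0
sumℤ (x ∷ xs) = x Data.Integer.+ sumℤ xs

DV : ∀ {n} → Lottery n → Fin n → ℤ
DV L i = sumℤ (Data.List.map
  (λ e → indicator (movesRight e == i) - indicator (movesLeft e == i)) (trace L))

swaps : ∀ {n} → Config n × Fin n → Fin n → Fin n → Bool
swaps e i j = (movesRight e == i ∧ movesLeft e == j) ∨ (movesRight e == j ∧ movesLeft e == i)

crossCount : ∀ {n} → Lottery n → Fin n → Fin n → ℕ
crossCount L i j = length (filterᵇ (λ e → swaps e i j) (trace L))

Realises : ∀ {n} → Permutation′ n → Lottery n → Set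
Realises π L = ∀ j → run L j ≡ π ⟨$⟩ʳ j

InL1 : ∀ {n} → Permutation′ n → Lottery n → Set
InL1 π L = Realises π L × (∀ i j → i ≢ j → crossCount L i j ≤ 1)

InL1y : ∀ {n} → Permutation′ n → (Fin n → ℤ) → Lottery n → Set
InL1y π y L = InL1 π L × (∀ i → DV L i ≡ y i)

AlmostOptimal : ∀ {n} → Permutation′ n → (Fin n → ℤ) → Set
AlmostOptimal π y = ∃ λ L → InL1y π y L

isPositive : ℕ → Bool
isPositive zero = false
isPositive (suc _) = true

crossesᵇ : ∀ {n} → Lottery n → Fin n → Fin n → Bool
crossesᵇ L i j = isPositive (crossCount L i j)

tangledᵇ : ∀ {n} → Lottery n → Fin n → Fin n → Fin n → Bool
tangledᵇ L a b c = crossesᵇ L a b ∧ crossesᵇ L b c ∧ crossesᵇ L a c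

inTriple : ∀ {n} → Fin n → Fin n → Fin n → Fin n → Bool
inTriple a b c x = x == a ∨ x == b ∨ x == c

tripleTrace : ∀ {n} → Lottery n → Fin n → Fin n → Fin n → List (Config n × Fin n)
tripleTrace L a b c =
  filterᵇ (λ e → inTriple a b c (movesRight e) ∧ inTriple a b c (movesLeft e)
                 ∧ not (movesRight e == movesLeft e)) (trace L)

-- Restricted to a tangled triple (in 𝓛¹), the three intersections in
-- top-to-bottom order are p, q, r.  p is the crossing of two pseudolines
-- x, y; q is where the third pseudoline z crosses one of them.  The region
-- enclosed lies on the side of q towards which z moves, so p,q,r are
-- counterclockwise (left tangled) iff z moves one line to the right at q.
middleCondition : ∀ {n} → List (Config n × Fin n) → Bool
middleCondition (p ∷ q ∷ r ∷ []) =
  not (movesRight q == movesRight p) ∧ not (movesRight q == movesLeft p)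
middleCondition _ = false

leftTangledᵇ : ∀ {n} → Lottery n → Fin n → Fin n → Fin n → Bool
leftTangledᵇ L a b c = tangledᵇ L a b c ∧ middleCondition (tripleTrace L a b c)

triples : (n : ℕ) → List (Fin n × Fin n × Fin n)
triples n = concatMap (λ a → concatMap (λ b → concatMap (λ c →
    if ⌊ a F.<? b ⌋ ∧ ⌊ b F.<? c ⌋ then (a , b , c) ∷ [] else [])
  (allFin n)) (allFin n)) (allFin n)

inLT : ∀ {n} → Lottery n → Fin n × Fin n × Fin n → Bool
inLT L (a , b , c) = leftTangledᵇ L a b c

symDiffLT : ∀ {n} → Lottery n → Lottery n → ℕ
symDiffLT {n} L L' = length (filterᵇ (λ t → inLT L t xor inLT L' t) (triples n))

-- Identification of lotteries as pseudoline arrangements: two adjacent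
-- bars on disjoint pairs of lines may be exchanged (cost 0).

Disjoint : ∀ {n} → Fin n → Fin n → Set
Disjoint a b = (a ≢ b) × (a ≢ next b) × (next a ≢ b) × (next a ≢ next b)

data Commute {n} : Lottery n → Lottery n → Set where
  comm : ∀ u v a b → Disjoint a b → Commute (u ++ a ∷ b ∷ v) (u ++ b ∷ a ∷ v)

data Braid {n} : Lottery n → Lottery n → Set where
  braidLR : ∀ u v k →
    Braid (u ++ k ∷ next k ∷ k ∷ v) (u ++ next k ∷ k ∷ next k ∷ v)
  braidRL : ∀ u v k →
    Braid (u ++ next k ∷ k ∷ next k ∷ v) (u ++ k ∷ next k ∷ k ∷ v)

-- Transform L into L' using exactly m braid relations (and any number of
-- identifications).  opt_CLL(L,L') is the least m with L ⟶[ m ] L'.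
data _⟶[_]_ {n} : Lottery n → ℕ → Lottery n → Set where
  done  : ∀ {L} → L ⟶[ 0 ] L
  commS : ∀ {L L' L'' m} → Commute L L' → L' ⟶[ m ] L'' → L ⟶[ m ] L''
  braidS : ∀ {L L' L'' m} → Braid L L' → L' ⟶[ m ] L'' → L ⟶[ suc m ] L''

-- Read a lottery through its sequence of crossings: for every bar, the pair
-- (element moving right, element moving left).  Whether a triple is left
-- tangled only depends on how often its pseudolines cross pairwise and on the
-- order of the crossings among them.  Exchanging two bars on disjoint lines
-- swaps two adjacent crossings of four distinct elements, and a braid relation
-- on the elements x, y, z of lines k, k+1, k+2 reverses the crossings
-- (x,y) (x,z) (y,z).  A triple sees at most one crossing of such a window,
-- unless it is {x, y, z}; so an exchange leaves LT unchanged and a braid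
-- relation changes it in at most one triple.  As |LT(L) △ LT(L')| satisfies the
-- triangle inequality, it is bounded by the number of braid relations.
module Submission where

open import Defs
open import Data.Nat using (ℕ; zero; suc; _≤_; _+_; z≤n; s≤s)
open import Data.Nat.Properties
  using ( ≤-refl; ≤-reflexive; ≤-trans; <⇒≤; <-trans; n≤1+n; +-mono-≤; +-monoʳ-≤; +-monoˡ-≤
        ; +-suc; suc-injective; 1+n≢n; 0≢1+n; m≢1+n+m; ≮⇒≥; module ≤-Reasoning)
import Data.Nat.Properties as ℕ
open import Data.Integer using (ℤ)
open import Data.Fin using (Fin; toℕ; _≟_)
import Data.Fin as Fin
open import Data.Fin.Properties using (toℕ-fromℕ<; toℕ<n; ≤-antisym; <-irrefl)
open import Data.Fin.Permutation using (Permutation′; transpose; _⟨$⟩ʳ_; _⟨$⟩ˡ_; inverseˡ)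
open import Data.Bool using (Bool; T; true; false; _∧_; _∨_; not; _xor_; if_then_else_)
open import Data.Bool.Properties using (T?; T-∧; T-∨)
open import Data.List using (List; []; _∷_; _++_; length; map; reverse; filterᵇ; concatMap; allFin; foldl)
open import Data.List.Properties using (filter-none; filter-accept; filter-reject; filter-++; length-map)
open import Data.List.Membership.Propositional using (_∈_)
open import Data.List.Relation.Binary.Subset.Propositional using (_⊆_)
open import Data.List.Relation.Binary.Disjoint.Propositional using () renaming (Disjoint to DisjointLists)
open import Data.List.Relation.Binary.Permutation.Propositional using (_↭_)
open import Data.List.Relation.Binary.Permutation.Propositional.Properties
  using (↭-length; ↭-reverse; filter-↭; ++⁺ˡ; ++⁺ʳ; ↭-empty-inv; ↭-singleton-inv)
open import Data.List.Relation.Unary.Any using (here; there; any?)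
open import Data.List.Relation.Unary.All as All using (All; []; _∷_)
import Data.List.Relation.Unary.All.Properties as All
open import Data.List.Relation.Unary.AllPairs as AllPairs using (AllPairs; []; _∷_)
import Data.List.Relation.Unary.AllPairs.Properties as AllPairs
open import Data.List.Relation.Unary.Unique.Propositional using (Unique)
import Data.List.Relation.Unary.Unique.Propositional.Properties as Unique
open import Data.Product using (_×_; _,_; proj₁; proj₂; ∃; ∃₂)
open import Data.Sum using (_⊎_; inj₁; inj₂)
open import Data.Empty using (⊥; ⊥-elim)
open import Function using (_∘_; case_of_; Equivalence)
open import Function.Definitions using (Injective)
open import Relation.Binary.PropositionalEquality
open import Relation.Nullary using (¬_; Dec; yes; no; contradiction)
open import Relation.Nullary.Decidable using (toWitness; ⌊_⌋)

-- Bars acting on configurations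

module _ {n : ℕ} where

  ==-refl : (a : Fin n) → (a == a) ≡ true
  ==-refl a with a ≟ a
  ... | yes _ = refl
  ... | no a≢a = contradiction refl a≢a

  ==-≢ : {a b : Fin n} → a ≢ b → (a == b) ≡ false
  ==-≢ {a} {b} a≢b with a ≟ b
  ... | yes a≡b = contradiction a≡b a≢b
  ... | no _ = refl

  applyBar-left : (k : Fin n) (σ : Config n) → applyBar k σ k ≡ σ (next k)
  applyBar-left k σ rewrite ==-refl k = refl

  applyBar-right : (k : Fin n) (σ : Config n) → applyBar k σ (next k) ≡ σ k
  applyBar-right k σ with next k ≟ k
  ... | yes nk≡k = cong σ nk≡k
  ... | no _ rewrite ==-refl (next k) = refl

  applyBar-away : (k : Fin n) (σ : Config n) {j : Fin n} →
                  j ≢ k → j ≢ next k → applyBar k σ j ≡ σ j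
  applyBar-away k σ j≢k j≢nk rewrite ==-≢ j≢k | ==-≢ j≢nk = refl

  applyBar-transpose : (k : Fin n) (σ : Config n) (j : Fin n) →
                       applyBar k σ j ≡ σ (transpose k (next k) ⟨$⟩ʳ j)
  applyBar-transpose k σ j with j ≟ k
  ... | yes _ = refl
  ... | no _ with j ≟ next k
  ...   | yes _ = refl
  ...   | no _ = refl

  applyBar-cong : (k : Fin n) {σ τ : Config n} → σ ≗ τ → applyBar k σ ≗ applyBar k τ
  applyBar-cong k {σ} {τ} σ≗τ j = begin
    applyBar k σ j                   ≡⟨ applyBar-transpose k σ j ⟩
    σ (transpose k (next k) ⟨$⟩ʳ j)  ≡⟨ σ≗τ _ ⟩
    τ (transpose k (next k) ⟨$⟩ʳ j)  ≡⟨ applyBar-transpose k τ j ⟨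
    applyBar k τ j                   ∎
    where open ≡-Reasoning

  applyBar-injective : (k : Fin n) {σ : Config n} →
                       Injective _≡_ _≡_ σ → Injective _≡_ _≡_ (applyBar k σ)
  applyBar-injective k {σ} σ-inj {i} {j} eq = begin
    i                  ≡⟨ inverseˡ τ ⟨
    τ ⟨$⟩ˡ (τ ⟨$⟩ʳ i)  ≡⟨ cong (τ ⟨$⟩ˡ_) (σ-inj (trans (sym (applyBar-transpose k σ i))
                                                  (trans eq (applyBar-transpose k σ j)))) ⟩
    τ ⟨$⟩ˡ (τ ⟨$⟩ʳ j)  ≡⟨ inverseˡ τ ⟩
    j                  ∎
    where
    open ≡-Reasoning
    τ = transpose k (next k)

  applyBar-comm : {a b : Fin n} (σ : Config n) → Disjoint a b →
                  applyBar b (applyBar a σ) ≗ applyBar a (applyBar b σ)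
  applyBar-comm {a} {b} σ (a≢b , a≢nb , na≢b , na≢nb) j =
    go (j ≟ a) (j ≟ next a) (j ≟ b) (j ≟ next b)
    where
    σᵃ σᵇ : Config n
    σᵃ = applyBar a σ
    σᵇ = applyBar b σ
    go : Dec (j ≡ a) → Dec (j ≡ next a) → Dec (j ≡ b) → Dec (j ≡ next b) →
         applyBar b σᵃ j ≡ applyBar a σᵇ j
    go (yes refl) _ _ _ =
      trans (trans (applyBar-away b σᵃ a≢b a≢nb) (applyBar-left a σ))
            (sym (trans (applyBar-left a σᵇ) (applyBar-away b σ na≢b na≢nb)))
    go (no _) (yes refl) _ _ =
      trans (trans (applyBar-away b σᵃ na≢b na≢nb) (applyBar-right a σ))
            (sym (trans (applyBar-right a σᵇ) (applyBar-away b σ a≢b a≢nb)))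
    go (no _) (no _) (yes refl) _ =
      trans (trans (applyBar-left b σᵃ) (applyBar-away a σ (≢-sym a≢nb) (≢-sym na≢nb)))
            (sym (trans (applyBar-away a σᵇ (≢-sym a≢b) (≢-sym na≢b)) (applyBar-left b σ)))
    go (no _) (no _) (no _) (yes refl) =
      trans (trans (applyBar-right b σᵃ) (applyBar-away a σ (≢-sym a≢b) (≢-sym na≢b)))
            (sym (trans (applyBar-away a σᵇ (≢-sym a≢nb) (≢-sym na≢nb)) (applyBar-right b σ)))
    go (no j≢a) (no j≢na) (no j≢b) (no j≢nb) =
      trans (trans (applyBar-away b σᵃ j≢b j≢nb) (applyBar-away a σ j≢a j≢na))
            (sym (trans (applyBar-away a σᵇ j≢a j≢na) (applyBar-away b σ j≢b j≢nb)))

  -- σᵢ and τᵢ are the configurations after i bars of the two sides of a braid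
  -- relation at k (written nk, nnk for k+1, k+2).
  module BraidBars {k : Fin n} (σ : Config n)
                   (k≢nk : k ≢ next k) (k≢nnk : k ≢ next (next k)) (nk≢nnk : next k ≢ next (next k))
                   where

    private
      nk nnk : Fin n
      nk = next k
      nnk = next nk

    σ₁ σ₂ σ₃ τ₁ τ₂ τ₃ : Config n
    σ₁ = applyBar k σ
    σ₂ = applyBar nk σ₁
    σ₃ = applyBar k σ₂
    τ₁ = applyBar nk σ
    τ₂ = applyBar k τ₁
    τ₃ = applyBar nk τ₂

    σ₁-nk : σ₁ nk ≡ σ k
    σ₁-nk = applyBar-right k σ

    σ₁-nnk : σ₁ nnk ≡ σ nnk
    σ₁-nnk = applyBar-away k σ (≢-sym k≢nnk) (≢-sym nk≢nnk)

    σ₂-k : σ₂ k ≡ σ nk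
    σ₂-k = trans (applyBar-away nk σ₁ k≢nk k≢nnk) (applyBar-left k σ)

    σ₂-nk : σ₂ nk ≡ σ nnk
    σ₂-nk = trans (applyBar-left nk σ₁) σ₁-nnk

    τ₁-k : τ₁ k ≡ σ k
    τ₁-k = applyBar-away nk σ k≢nk k≢nnk

    τ₁-nk : τ₁ nk ≡ σ nnk
    τ₁-nk = applyBar-left nk σ

    τ₂-nk : τ₂ nk ≡ σ k
    τ₂-nk = trans (applyBar-right k τ₁) τ₁-k

    τ₂-nnk : τ₂ nnk ≡ σ nk
    τ₂-nnk = trans (applyBar-away k τ₁ (≢-sym k≢nnk) (≢-sym nk≢nnk)) (applyBar-right nk σ)

    σ₃≗τ₃ : σ₃ ≗ τ₃
    σ₃≗τ₃ j = go (j ≟ k) (j ≟ nk) (j ≟ nnk)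
      where
      go : Dec (j ≡ k) → Dec (j ≡ nk) → Dec (j ≡ nnk) → σ₃ j ≡ τ₃ j
      go (yes refl) _ _ =
        trans (trans (applyBar-left k σ₂) σ₂-nk)
              (sym (trans (applyBar-away nk τ₂ k≢nk k≢nnk) (trans (applyBar-left k τ₁) τ₁-nk)))
      go (no _) (yes refl) _ =
        trans (trans (applyBar-right k σ₂) σ₂-k) (sym (trans (applyBar-left nk τ₂) τ₂-nnk))
      go (no _) (no _) (yes refl) =
        trans (trans (applyBar-away k σ₂ (≢-sym k≢nnk) (≢-sym nk≢nnk))
                     (trans (applyBar-right nk σ₁) σ₁-nk))
              (sym (trans (applyBar-right nk τ₂) τ₂-nk))
      go (no j≢k) (no j≢nk) (no j≢nnk) =
        trans (trans (applyBar-away k σ₂ j≢k j≢nk)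
                     (trans (applyBar-away nk σ₁ j≢nk j≢nnk) (applyBar-away k σ j≢k j≢nk)))
              (sym (trans (applyBar-away nk τ₂ j≢nk j≢nnk)
                     (trans (applyBar-away k τ₁ j≢k j≢nk) (applyBar-away nk σ j≢nk j≢nnk))))

toℕ-next : {m : ℕ} (k : Fin (suc m)) →
           toℕ (next k) ≡ suc (toℕ k) ⊎ (toℕ (next k) ≡ 0 × suc (toℕ k) ≡ suc m)
toℕ-next {m} k with suc (toℕ k) ℕ.<? suc m
... | yes k+1<n = inj₁ (toℕ-fromℕ< k+1<n)
... | no k+1≮n = inj₂ (refl , ℕ.≤-antisym (toℕ<n k) (≮⇒≥ k+1≮n))

next-≢ : {m : ℕ} (k : Fin (2 + m)) → next k ≢ k
next-≢ {m} k nk≡k with toℕ-next k | cong toℕ nk≡k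
... | inj₁ nk=k+1 | nk=k = 1+n≢n (trans (sym nk=k+1) nk=k)
... | inj₂ (nk=0 , k+1=n) | nk=k =
  0≢1+n (suc-injective (subst (λ x → suc x ≡ 2 + m) (trans (sym nk=k) nk=0) k+1=n))

-- Going around the cycle in two steps needs n ≤ 2.
next²-≢ : {m : ℕ} (k : Fin (3 + m)) → next (next k) ≢ k
next²-≢ {m} k nnk≡k with toℕ-next k | toℕ-next (next k) | cong toℕ nnk≡k
... | inj₁ nk=k+1 | inj₁ nnk=nk+1 | nnk=k =
  m≢1+n+m (toℕ k) (trans (sym nnk=k) (trans nnk=nk+1 (cong suc nk=k+1)))
... | inj₁ nk=k+1 | inj₂ (nnk=0 , nk+1=n) | nnk=k
  with () ← trans (sym (cong suc (trans nk=k+1 (cong suc (trans (sym nnk=k) nnk=0))))) nk+1=n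
... | inj₂ (nk=0 , k+1=n) | inj₁ nnk=nk+1 | nnk=k
  with () ← trans (sym (cong suc (trans (sym nnk=k) (trans nnk=nk+1 (cong suc nk=0))))) k+1=n
... | inj₂ (nk=0 , _) | inj₂ (_ , nk+1=n) | _ with () ← trans (sym (cong suc nk=0)) nk+1=n

-- Counting in lists

module _ {A : Set} where

  countᵇ : (A → Bool) → List A → ℕ
  countᵇ g xs = length (filterᵇ g xs)

  countᵇ-accept : {g : A → Bool} {x : A} (xs : List A) → T (g x) → countᵇ g (x ∷ xs) ≡ suc (countᵇ g xs)
  countᵇ-accept {g} xs gx = cong length (filter-accept (T? ∘ g) gx)

  countᵇ-reject : {g : A → Bool} {x : A} (xs : List A) → ¬ T (g x) → countᵇ g (x ∷ xs) ≡ countᵇ g xs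
  countᵇ-reject {g} xs ¬gx = cong length (filter-reject (T? ∘ g) ¬gx)

  countᵇ-≤-∷ : (g : A → Bool) (x : A) (xs : List A) → countᵇ g xs ≤ countᵇ g (x ∷ xs)
  countᵇ-≤-∷ g x xs = case T? (g x) of λ
    { (yes gx) → ≤-trans (n≤1+n _) (≤-reflexive (sym (countᵇ-accept xs gx)))
    ; (no ¬gx) → ≤-reflexive (sym (countᵇ-reject xs ¬gx)) }

  countᵇ-none : {g : A → Bool} {xs : List A} → All (¬_ ∘ T ∘ g) xs → countᵇ g xs ≡ 0
  countᵇ-none {g} none = cong length (filter-none (T? ∘ g) none)

  countᵇ-≤1 : {g : A → Bool} {xs : List A} → AllPairs (λ x y → T (g x) → ¬ T (g y)) xs → countᵇ g xs ≤ 1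
  countᵇ-≤1 [] = z≤n
  countᵇ-≤1 {g} {x ∷ xs} (notBoth ∷ rest) = case T? (g x) of λ
    { (yes gx) → ≤-reflexive (trans (countᵇ-accept xs gx)
                                     (cong suc (countᵇ-none (All.map (λ h → h gx) notBoth))))
    ; (no ¬gx) → ≤-trans (≤-reflexive (countᵇ-reject xs ¬gx)) (countᵇ-≤1 rest) }

  countᵇ-≤-+ : {f g h : A → Bool} → (∀ x → T (f x) → T (g x) ⊎ T (h x)) →
               (xs : List A) → countᵇ f xs ≤ countᵇ g xs + countᵇ h xs
  countᵇ-≤-+ cover [] = z≤n
  countᵇ-≤-+ {f} {g} {h} cover (x ∷ xs) = step (T? (f x))
    where
    open ≤-Reasoning
    ih = countᵇ-≤-+ cover xs
    step : Dec (T (f x)) → countᵇ f (x ∷ xs) ≤ countᵇ g (x ∷ xs) + countᵇ h (x ∷ xs)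
    step (no ¬fx) = begin
      countᵇ f (x ∷ xs)                      ≡⟨ countᵇ-reject xs ¬fx ⟩
      countᵇ f xs                            ≤⟨ ih ⟩
      countᵇ g xs + countᵇ h xs              ≤⟨ +-mono-≤ (countᵇ-≤-∷ g x xs) (countᵇ-≤-∷ h x xs) ⟩
      countᵇ g (x ∷ xs) + countᵇ h (x ∷ xs)  ∎
    step (yes fx) with cover x fx
    ... | inj₁ gx = begin
      countᵇ f (x ∷ xs)                      ≡⟨ countᵇ-accept xs fx ⟩
      suc (countᵇ f xs)                      ≤⟨ s≤s ih ⟩
      suc (countᵇ g xs + countᵇ h xs)        ≤⟨ s≤s (+-monoʳ-≤ _ (countᵇ-≤-∷ h x xs)) ⟩
      suc (countᵇ g xs) + countᵇ h (x ∷ xs)  ≡⟨ cong (_+ _) (countᵇ-accept xs gx) ⟨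
      countᵇ g (x ∷ xs) + countᵇ h (x ∷ xs)  ∎
    ... | inj₂ hx = begin
      countᵇ f (x ∷ xs)                      ≡⟨ countᵇ-accept xs fx ⟩
      suc (countᵇ f xs)                      ≤⟨ s≤s ih ⟩
      suc (countᵇ g xs + countᵇ h xs)        ≤⟨ s≤s (+-monoˡ-≤ _ (countᵇ-≤-∷ g x xs)) ⟩
      suc (countᵇ g (x ∷ xs) + countᵇ h xs)  ≡⟨ +-suc _ _ ⟨
      countᵇ g (x ∷ xs) + suc (countᵇ h xs)  ≡⟨ cong (_ +_) (countᵇ-accept xs hx) ⟨
      countᵇ g (x ∷ xs) + countᵇ h (x ∷ xs)  ∎

  map-filterᵇ : {B : Set} (f : B → A) (g : A → Bool) (xs : List B) →
                map f (filterᵇ (g ∘ f) xs) ≡ filterᵇ g (map f xs)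
  map-filterᵇ f g [] = refl
  map-filterᵇ f g (x ∷ xs) with g (f x)
  ... | true = cong (f x ∷_) (map-filterᵇ f g xs)
  ... | false = map-filterᵇ f g xs

  private
    ↭-short : {xs ys : List A} → xs ↭ ys → length ys ≤ 1 → xs ≡ ys
    ↭-short {ys = []} p _ = ↭-empty-inv p
    ↭-short {ys = _ ∷ []} p _ = ↭-singleton-inv p
    ↭-short {ys = _ ∷ _ ∷ _} _ (s≤s ())

  countᵇ-reverse-window : (g : A → Bool) (P W S : List A) →
                          countᵇ g (P ++ W ++ S) ≡ countᵇ g (P ++ reverse W ++ S)
  countᵇ-reverse-window g P W S = sym (↭-length (filter-↭ (T? ∘ g) (++⁺ˡ P (++⁺ʳ S (↭-reverse W)))))

  filterᵇ-reverse-window : (g : A → Bool) (P W S : List A) → countᵇ g W ≤ 1 →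
                           filterᵇ g (P ++ W ++ S) ≡ filterᵇ g (P ++ reverse W ++ S)
  filterᵇ-reverse-window g P W S short = begin
    filterᵇ g (P ++ W ++ S)                              ≡⟨ filter-++ (T? ∘ g) P (W ++ S) ⟩
    filterᵇ g P ++ filterᵇ g (W ++ S)                    ≡⟨ cong (filterᵇ g P ++_) (filter-++ (T? ∘ g) W S) ⟩
    filterᵇ g P ++ filterᵇ g W ++ filterᵇ g S            ≡⟨ cong (λ F → filterᵇ g P ++ F ++ filterᵇ g S) fW≡fW′ ⟩
    filterᵇ g P ++ filterᵇ g (reverse W) ++ filterᵇ g S
      ≡⟨ cong (filterᵇ g P ++_) (filter-++ (T? ∘ g) (reverse W) S) ⟨
    filterᵇ g P ++ filterᵇ g (reverse W ++ S)            ≡⟨ filter-++ (T? ∘ g) P (reverse W ++ S) ⟨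
    filterᵇ g (P ++ reverse W ++ S)                      ∎
    where
    open ≡-Reasoning
    fW≡fW′ : filterᵇ g W ≡ filterᵇ g (reverse W)
    fW≡fW′ = sym (↭-short (filter-↭ (T? ∘ g) (↭-reverse W)) short)

  AllPairs-mapWithAll : {P : A → Set} {R S : A → A → Set} → (∀ {x y} → P x → P y → R x y → S x y) →
                        {xs : List A} → All P xs → AllPairs R xs → AllPairs S xs
  AllPairs-mapWithAll f [] [] = []
  AllPairs-mapWithAll f (px ∷ pxs) (rx ∷ rxs) =
    All.zipWith (λ (py , r) → f px py r) (pxs , rx) ∷ AllPairs-mapWithAll f pxs rxs

module _ {A B : Set} {f : A → List B} where

  All-concatMap⁺ : {P : B → Set} → (∀ a → All P (f a)) → (xs : List A) → All P (concatMap f xs)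
  All-concatMap⁺ Pf xs = All.concat⁺ (All.map⁺ (All.universal Pf xs))

  Unique-concatMap⁺ : (key : B → A) → (∀ a → All (λ b → key b ≡ a) (f a)) →
                      (∀ a → Unique (f a)) → {xs : List A} → Unique xs → Unique (concatMap f xs)
  Unique-concatMap⁺ key keyed f! {xs} xs! =
    Unique.concat⁺ (All.map⁺ (All.universal f! xs)) (AllPairs.map⁺ (AllPairs.map disjoint xs!))
    where
    disjoint : ∀ {a a′} → a ≢ a′ → DisjointLists (f a) (f a′)
    disjoint a≢a′ (b∈fa , b∈fa′) =
      a≢a′ (trans (sym (All.lookup (keyed _) b∈fa)) (All.lookup (keyed _) b∈fa′))

-- The sequence of crossings of a lottery

Crossing : ℕ → Set
Crossing n = Fin n × Fin n

data ReversesWindow {A : Set} (W : List A) : List A → List A → Set where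
  reverseWindow : (P S : List A) → ReversesWindow W (P ++ W ++ S) (P ++ reverse W ++ S)

reverseWindow′ : {A : Set} {W P S xs ys : List A} →
                 xs ≡ P ++ W ++ S → ys ≡ P ++ reverse W ++ S → ReversesWindow W xs ys
reverseWindow′ {P = P} {S} refl refl = reverseWindow P S

module _ {n : ℕ} where

  runFrom : Config n → Lottery n → Config n
  runFrom σ = foldl (λ τ k → applyBar k τ) σ

  runFrom-injective : {σ : Config n} → Injective _≡_ _≡_ σ →
                      (u : Lottery n) → Injective _≡_ _≡_ (runFrom σ u)
  runFrom-injective σ-inj [] = σ-inj
  runFrom-injective σ-inj (k ∷ u) = runFrom-injective (applyBar-injective k σ-inj) u

  run-injective : (u : Lottery n) → Injective _≡_ _≡_ (run u)
  run-injective = runFrom-injective (λ eq → eq)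

  crossing : Config n × Fin n → Crossing n
  crossing e = movesRight e , movesLeft e

  crossingsFrom : Config n → Lottery n → List (Crossing n)
  crossingsFrom σ L = map crossing (traceFrom σ L)

  crossings : Lottery n → List (Crossing n)
  crossings = crossingsFrom (λ i → i)

  crossingsFrom-++ : (σ : Config n) (u v : Lottery n) →
                     crossingsFrom σ (u ++ v) ≡ crossingsFrom σ u ++ crossingsFrom (runFrom σ u) v
  crossingsFrom-++ σ [] v = refl
  crossingsFrom-++ σ (k ∷ u) v = cong (crossing (σ , k) ∷_) (crossingsFrom-++ (applyBar k σ) u v)

  crossingsFrom-cong : {σ τ : Config n} → σ ≗ τ → (L : Lottery n) → crossingsFrom σ L ≡ crossingsFrom τ L
  crossingsFrom-cong σ≗τ [] = refl
  crossingsFrom-cong σ≗τ (k ∷ L) =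
    cong₂ _∷_ (cong₂ _,_ (σ≗τ k) (σ≗τ (next k))) (crossingsFrom-cong (applyBar-cong k σ≗τ) L)

module _ {m : ℕ} where

  private
    n = 3 + m

  record CommutingWindow (C C′ : List (Crossing n)) : Set where
    field
      w₁ w₂ w₃ w₄ : Fin n
      distinct : Unique (w₁ ∷ w₂ ∷ w₃ ∷ w₄ ∷ [])
      reverses : ReversesWindow ((w₁ , w₂) ∷ (w₃ , w₄) ∷ []) C C′

  commute-window : {L L′ : Lottery n} → Commute L L′ → CommutingWindow (crossings L) (crossings L′)
  commute-window (comm u v a b disj@(a≢b , a≢nb , na≢b , na≢nb)) = record
    { w₁ = σ a ; w₂ = σ (next a) ; w₃ = σ b ; w₄ = σ (next b)
    ; distinct = Unique.map⁺ (run-injective u) lines-distinct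
    ; reverses = reverseWindow′
        (trans (crossingsFrom-++ _ u (a ∷ b ∷ v))
          (cong (λ c → crossings u ++ (σ a , σ (next a)) ∷ c ∷ crossingsFrom σᵃᵇ v)
                (cong₂ _,_ (applyBar-away a σ (≢-sym a≢b) (≢-sym na≢b))
                           (applyBar-away a σ (≢-sym a≢nb) (≢-sym na≢nb)))))
        (trans (crossingsFrom-++ _ u (b ∷ a ∷ v))
          (cong₂ (λ c S → crossings u ++ (σ b , σ (next b)) ∷ c ∷ S)
                 (cong₂ _,_ (applyBar-away b σ a≢b a≢nb) (applyBar-away b σ na≢b na≢nb))
                 (crossingsFrom-cong (λ j → sym (applyBar-comm σ disj j)) v)))
    }
    where
    σ = run u
    σᵃᵇ = applyBar b (applyBar a σ)
    lines-distinct : Unique (a ∷ next a ∷ b ∷ next b ∷ [])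
    lines-distinct =
      (≢-sym (next-≢ a) ∷ a≢b ∷ a≢nb ∷ []) ∷ (na≢b ∷ na≢nb ∷ []) ∷ (≢-sym (next-≢ b) ∷ []) ∷ [] ∷ []

  record BraidWindow (C C′ : List (Crossing n)) : Set where
    field
      x y z : Fin n
      distinct : Unique (x ∷ y ∷ z ∷ [])
      reverses : ReversesWindow ((x , y) ∷ (x , z) ∷ (y , z) ∷ []) C C′

  braid-window : (u v : Lottery n) (k : Fin n) →
                 BraidWindow (crossings (u ++ k ∷ next k ∷ k ∷ v)) (crossings (u ++ next k ∷ k ∷ next k ∷ v))
  braid-window u v k = record
    { x = σ k ; y = σ (next k) ; z = σ (next (next k))
    ; distinct = Unique.map⁺ (run-injective u) ((k≢nk ∷ k≢nnk ∷ []) ∷ (nk≢nnk ∷ []) ∷ [] ∷ [])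
    ; reverses = reverseWindow′
        (trans (crossingsFrom-++ _ u (k ∷ next k ∷ k ∷ v))
          (cong₂ (λ c d → crossings u ++ (σ k , σ (next k)) ∷ c ∷ d ∷ crossingsFrom σ₃ v)
                 (cong₂ _,_ σ₁-nk σ₁-nnk) (cong₂ _,_ σ₂-k σ₂-nk)))
        (trans (crossingsFrom-++ _ u (next k ∷ k ∷ next k ∷ v))
          (cong₂ (λ c S → crossings u ++ (σ (next k) , σ (next (next k))) ∷ c ∷ S)
                 (cong₂ _,_ τ₁-k τ₁-nk)
                 (cong₂ _∷_ (cong₂ _,_ τ₂-nk τ₂-nnk) (crossingsFrom-cong (λ j → sym (σ₃≗τ₃ j)) v))))
    }
    where
    σ = run u
    k≢nk : k ≢ next k
    k≢nk = ≢-sym (next-≢ k)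
    k≢nnk : k ≢ next (next k)
    k≢nnk = ≢-sym (next²-≢ k)
    nk≢nnk : next k ≢ next (next k)
    nk≢nnk = ≢-sym (next-≢ (next k))
    open BraidBars σ k≢nk k≢nnk nk≢nnk

-- Triples

Triple : ℕ → Set
Triple n = Fin n × Fin n × Fin n

module _ {n : ℕ} where

  members : Triple n → List (Fin n)
  members (a , b , c) = a ∷ b ∷ c ∷ []

  Sorted : Triple n → Set
  Sorted (a , b , c) = a Fin.< b × b Fin.< c

  inTriple-∈ : {a b c w : Fin n} → T (inTriple a b c w) → w ∈ members (a , b , c)
  inTriple-∈ {a} {b} {c} {w} h with Equivalence.to (T-∨ {w == a}) h
  ... | inj₁ w≡a = here (toWitness {a? = w ≟ a} w≡a)
  ... | inj₂ h′ with Equivalence.to (T-∨ {w == b}) h′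
  ...   | inj₁ w≡b = there (here (toWitness {a? = w ≟ b} w≡b))
  ...   | inj₂ w≡c = there (there (here (toWitness {a? = w ≟ c} w≡c)))

  pigeonhole₂ : {w₁ w₂ w₃ p q : Fin n} → Unique (w₁ ∷ w₂ ∷ w₃ ∷ []) →
                (w₁ ∷ w₂ ∷ w₃ ∷ []) ⊆ (p ∷ q ∷ []) → ⊥
  pigeonhole₂ ((w₁≢w₂ ∷ w₁≢w₃ ∷ []) ∷ (w₂≢w₃ ∷ []) ∷ [] ∷ []) sub
    with sub (here refl) | sub (there (here refl)) | sub (there (there (here refl)))
  ... | here refl         | here refl         | _                 = w₁≢w₂ refl
  ... | there (here refl) | there (here refl) | _                 = w₁≢w₂ refl
  ... | here refl         | there (here refl) | here refl         = w₁≢w₃ refl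
  ... | here refl         | there (here refl) | there (here refl) = w₂≢w₃ refl
  ... | there (here refl) | here refl         | here refl         = w₂≢w₃ refl
  ... | there (here refl) | here refl         | there (here refl) = w₁≢w₃ refl

  ∈-members-remove : {w : Fin n} (t : Triple n) → w ∈ members t →
                     ∃₂ λ p q → ∀ {v} → v ∈ members t → v ≢ w → v ∈ p ∷ q ∷ []
  ∈-members-remove (a , b , c) (here refl) = b , c , λ
    { (here refl) v≢w → contradiction refl v≢w ; (there v∈) _ → v∈ }
  ∈-members-remove (a , b , c) (there (here refl)) = a , c , λ
    { (here refl) _ → here refl ; (there (here refl)) v≢w → contradiction refl v≢w
    ; (there (there v∈)) _ → there v∈ }
  ∈-members-remove (a , b , c) (there (there (here refl))) = a , b , λ
    { (here refl) _ → here refl ; (there (here refl)) _ → there (here refl)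
    ; (there (there (here refl))) v≢w → contradiction refl v≢w }

  pigeonhole₃ : {w₁ w₂ w₃ w₄ : Fin n} (t : Triple n) → Unique (w₁ ∷ w₂ ∷ w₃ ∷ w₄ ∷ []) →
                (w₁ ∷ w₂ ∷ w₃ ∷ w₄ ∷ []) ⊆ members t → ⊥
  pigeonhole₃ t ((w₁≢w₂ ∷ w₁≢w₃ ∷ w₁≢w₄ ∷ []) ∷ rest) sub
    with p , q , others ← ∈-members-remove t (sub (here refl)) = pigeonhole₂ rest λ
      { (here refl) → others (sub (there (here refl))) (≢-sym w₁≢w₂)
      ; (there (here refl)) → others (sub (there (there (here refl)))) (≢-sym w₁≢w₃)
      ; (there (there (here refl))) → others (sub (there (there (there (here refl))))) (≢-sym w₁≢w₄) }

  unique-members-⊆⇒⊇ : {u : Triple n} (t : Triple n) → Unique (members u) →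
                       members u ⊆ members t → members t ⊆ members u
  unique-members-⊆⇒⊇ {u = x , y , z} t u! u⊆t {w} w∈t with any? (w ≟_) (members (x , y , z))
  ... | yes w∈u = w∈u
  ... | no w∉u = ⊥-elim (pigeonhole₃ t (extend u!) λ
      { (here refl) → u⊆t (here refl)
      ; (there (here refl)) → u⊆t (there (here refl))
      ; (there (there (here refl))) → u⊆t (there (there (here refl)))
      ; (there (there (there (here refl)))) → w∈t })
    where
    extend : Unique (x ∷ y ∷ z ∷ []) → Unique (x ∷ y ∷ z ∷ w ∷ [])
    extend ((x≢y ∷ x≢z ∷ []) ∷ (y≢z ∷ []) ∷ [] ∷ []) =
      (x≢y ∷ x≢z ∷ (λ x≡w → w∉u (here (sym x≡w))) ∷ [])
      ∷ (y≢z ∷ (λ y≡w → w∉u (there (here (sym y≡w)))) ∷ [])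
      ∷ ((λ z≡w → w∉u (there (there (here (sym z≡w))))) ∷ []) ∷ [] ∷ []

  Sorted-min≤ : {t : Triple n} → Sorted t → {w : Fin n} → w ∈ members t → proj₁ t Fin.≤ w
  Sorted-min≤ _ (here refl) = ≤-refl
  Sorted-min≤ (a<b , _) (there (here refl)) = <⇒≤ a<b
  Sorted-min≤ (a<b , b<c) (there (there (here refl))) = <⇒≤ (<-trans a<b b<c)

  Sorted-≤max : {t : Triple n} → Sorted t → {w : Fin n} → w ∈ members t → w Fin.≤ proj₂ (proj₂ t)
  Sorted-≤max (a<b , b<c) (here refl) = <⇒≤ (<-trans a<b b<c)
  Sorted-≤max (_ , b<c) (there (here refl)) = <⇒≤ b<c
  Sorted-≤max _ (there (there (here refl))) = ≤-refl

  sorted-≡ : {s s′ : Triple n} → Sorted s → Sorted s′ →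
             members s ⊆ members s′ → members s′ ⊆ members s → s ≡ s′
  sorted-≡ {a , b , c} {a′ , b′ , c′} s↑ s′↑ s⊆s′ s′⊆s
    with refl ← ≤-antisym (Sorted-min≤ s↑ (s′⊆s (here refl))) (Sorted-min≤ s′↑ (s⊆s′ (here refl)))
       | refl ← ≤-antisym (Sorted-≤max s′↑ (s⊆s′ (there (there (here refl)))))
                          (Sorted-≤max s↑ (s′⊆s (there (there (here refl)))))
    with s⊆s′ (there (here refl))
  ... | here b≡a = ⊥-elim (<-irrefl (sym b≡a) (proj₁ s↑))
  ... | there (here refl) = refl
  ... | there (there (here b≡c)) = ⊥-elim (<-irrefl b≡c (proj₂ s↑))

  sorted-≡-containing : {u s s′ : Triple n} → Unique (members u) → Sorted s → Sorted s′ →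
                        members u ⊆ members s → members u ⊆ members s′ → s ≡ s′
  sorted-≡-containing {s = s} {s′} u! s↑ s′↑ u⊆s u⊆s′ =
    sorted-≡ s↑ s′↑ (u⊆s′ ∘ unique-members-⊆⇒⊇ s u! u⊆s) (u⊆s ∘ unique-members-⊆⇒⊇ s′ u! u⊆s′)

  private
    candidate : Fin n → Fin n → Fin n → List (Triple n)
    candidate a b c = if ⌊ a Fin.<? b ⌋ ∧ ⌊ b Fin.<? c ⌋ then (a , b , c) ∷ [] else []

    candidate-spec : (a b c : Fin n) → All (λ s → s ≡ (a , b , c) × Sorted s) (candidate a b c)
    candidate-spec a b c with a Fin.<? b | b Fin.<? c
    ... | yes a<b | yes b<c = (refl , a<b , b<c) ∷ []
    ... | yes _ | no _ = []
    ... | no _ | _ = []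

    candidate-unique : (a b c : Fin n) → Unique (candidate a b c)
    candidate-unique a b c with a Fin.<? b | b Fin.<? c
    ... | yes _ | yes _ = [] ∷ []
    ... | yes _ | no _ = []
    ... | no _ | _ = []

  triples-sorted : All Sorted (triples n)
  triples-sorted = All-concatMap⁺ (λ a → All-concatMap⁺ (λ b → All-concatMap⁺ (λ c →
    All.map proj₂ (candidate-spec a b c)) (allFin n)) (allFin n)) (allFin n)

  triples-unique : Unique (triples n)
  triples-unique =
    Unique-concatMap⁺ proj₁
      (λ a → All-concatMap⁺ (λ b → All-concatMap⁺ (λ c → keyed proj₁ a b c) (allFin n)) (allFin n))
      (λ a → Unique-concatMap⁺ (proj₁ ∘ proj₂)
               (λ b → All-concatMap⁺ (keyed (proj₁ ∘ proj₂) a b) (allFin n))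
               (λ b → Unique-concatMap⁺ (proj₂ ∘ proj₂) (keyed (proj₂ ∘ proj₂) a b) (candidate-unique a b)
                        (Unique.allFin⁺ n))
               (Unique.allFin⁺ n))
      (Unique.allFin⁺ n)
    where
    keyed : {X : Set} (key : Triple n → X) (a b c : Fin n) →
            All (λ s → key s ≡ key (a , b , c)) (candidate a b c)
    keyed key a b c = All.map (cong key ∘ proj₁) (candidate-spec a b c)

-- Left tangled triples, read off the crossings

module _ {n : ℕ} where

  swapsᶜ : Crossing n → Fin n → Fin n → Bool
  swapsᶜ (r , l) i j = (r == i ∧ l == j) ∨ (r == j ∧ l == i)

  crossCountᶜ : List (Crossing n) → Fin n → Fin n → ℕ
  crossCountᶜ C i j = countᵇ (λ c → swapsᶜ c i j) C

  involvesᶜ : Triple n → Crossing n → Bool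
  involvesᶜ (a , b , c) (r , l) = inTriple a b c r ∧ inTriple a b c l ∧ not (r == l)

  middleConditionᶜ : List (Crossing n) → Bool
  middleConditionᶜ (p ∷ q ∷ r ∷ []) = not (proj₁ q == proj₁ p) ∧ not (proj₁ q == proj₂ p)
  middleConditionᶜ _ = false

  leftTangledᶜ : List (Crossing n) → Triple n → Bool
  leftTangledᶜ C t@(a , b , c) =
    (isPositive (crossCountᶜ C a b) ∧ isPositive (crossCountᶜ C b c) ∧ isPositive (crossCountᶜ C a c))
    ∧ middleConditionᶜ (filterᵇ (involvesᶜ t) C)

  middleCondition-crossings : (es : List (Config n × Fin n)) →
                              middleCondition es ≡ middleConditionᶜ (map crossing es)
  middleCondition-crossings [] = refl
  middleCondition-crossings (_ ∷ []) = refl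
  middleCondition-crossings (_ ∷ _ ∷ []) = refl
  middleCondition-crossings (_ ∷ _ ∷ _ ∷ []) = refl
  middleCondition-crossings (_ ∷ _ ∷ _ ∷ _ ∷ _) = refl

  inLT-crossings : (L : Lottery n) (t : Triple n) → inLT L t ≡ leftTangledᶜ (crossings L) t
  inLT-crossings L t@(a , b , c) =
    cong₂ _∧_ (cong₂ _∧_ (positive a b) (cong₂ _∧_ (positive b c) (positive a c)))
              (trans (middleCondition-crossings (tripleTrace L a b c))
                     (cong middleConditionᶜ (map-filterᵇ crossing (involvesᶜ t) (trace L))))
    where
    positive : ∀ i j → crossesᵇ L i j ≡ isPositive (crossCountᶜ (crossings L) i j)
    positive i j = cong isPositive
      (trans (sym (length-map crossing (filterᵇ (λ e → swaps e i j) (trace L))))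
             (cong length (map-filterᵇ crossing (λ c → swapsᶜ c i j) (trace L))))

  leftTangledᶜ-reverse : {W C C′ : List (Crossing n)} → ReversesWindow W C C′ →
                         (t : Triple n) → countᵇ (involvesᶜ t) W ≤ 1 → leftTangledᶜ C t ≡ leftTangledᶜ C′ t
  leftTangledᶜ-reverse {W} (reverseWindow P S) t@(a , b , c) short =
    cong₂ _∧_ (cong₂ _∧_ (positive a b) (cong₂ _∧_ (positive b c) (positive a c)))
              (cong middleConditionᶜ (filterᵇ-reverse-window (involvesᶜ t) P W S short))
    where
    positive : ∀ i j → isPositive (crossCountᶜ (P ++ W ++ S) i j)
                     ≡ isPositive (crossCountᶜ (P ++ reverse W ++ S) i j)
    positive i j = cong isPositive (countᵇ-reverse-window (λ c → swapsᶜ c i j) P W S)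

  involvesᶜ-members : (t : Triple n) ((r , l) : Crossing n) → T (involvesᶜ t (r , l)) →
                      r ∈ members t × l ∈ members t
  involvesᶜ-members (a , b , c) (r , l) h with Equivalence.to (T-∧ {inTriple a b c r}) h
  ... | r∈t , h′ = inTriple-∈ r∈t , inTriple-∈ (proj₁ (Equivalence.to (T-∧ {inTriple a b c l}) h′))

module _ {m : ℕ} where

  private
    n = 3 + m

  commute-inLT : {L L′ : Lottery n} → Commute L L′ → inLT L ≗ inLT L′
  commute-inLT {L} {L′} commute t = begin
    inLT L t                       ≡⟨ inLT-crossings L t ⟩
    leftTangledᶜ (crossings L) t   ≡⟨ leftTangledᶜ-reverse reverses t (countᵇ-≤1 {g = involvesᶜ t} notBoth) ⟩
    leftTangledᶜ (crossings L′) t  ≡⟨ inLT-crossings L′ t ⟨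
    inLT L′ t                      ∎
    where
    open ≡-Reasoning
    open CommutingWindow (commute-window commute)
    pair : ∀ {ws} ((r , l) : Crossing n) → T (involvesᶜ t (r , l)) →
           All (_∈ members t) ws → All (_∈ members t) (r ∷ l ∷ ws)
    pair c i ws∈ = proj₁ (involvesᶜ-members t c i) ∷ proj₂ (involvesᶜ-members t c i) ∷ ws∈
    notBoth : AllPairs (λ c d → T (involvesᶜ t c) → ¬ T (involvesᶜ t d)) ((w₁ , w₂) ∷ (w₃ , w₄) ∷ [])
    notBoth =
      ((λ i₁₂ i₃₄ → pigeonhole₃ t distinct (All.lookup (pair (w₁ , w₂) i₁₂ (pair (w₃ , w₄) i₃₄ [])))) ∷ [])
      ∷ [] ∷ []

  AgreesOutside : Lottery n → Lottery n → Triple n → Set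
  AgreesOutside L L′ u = ∀ t → ¬ (members u ⊆ members t) → inLT L t ≡ inLT L′ t

  braidLR-inLT : (u v : Lottery n) (k : Fin n) → ∃ λ t₀ → Unique (members t₀) ×
                 AgreesOutside (u ++ k ∷ next k ∷ k ∷ v) (u ++ next k ∷ k ∷ next k ∷ v) t₀
  braidLR-inLT u v k = (x , y , z) , distinct , λ t u⊈t →
    trans (inLT-crossings (u ++ k ∷ next k ∷ k ∷ v) t)
      (trans (leftTangledᶜ-reverse reverses t (countᵇ-≤1 {g = involvesᶜ t} (notBoth t u⊈t)))
             (sym (inLT-crossings (u ++ next k ∷ k ∷ next k ∷ v) t)))
    where
    open BraidWindow (braid-window u v k)
    notBoth : ∀ t → ¬ (members (x , y , z) ⊆ members t) →
              AllPairs (λ c d → T (involvesᶜ t c) → ¬ T (involvesᶜ t d)) ((x , y) ∷ (x , z) ∷ (y , z) ∷ [])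
    notBoth t u⊈t =
      ((λ ixy ixz → u⊈t (spans (proj₁ (mem (x , y) ixy)) (proj₂ (mem (x , y) ixy)) (proj₂ (mem (x , z) ixz))))
       ∷ (λ ixy iyz → u⊈t (spans (proj₁ (mem (x , y) ixy)) (proj₂ (mem (x , y) ixy)) (proj₂ (mem (y , z) iyz))))
       ∷ [])
      ∷ ((λ ixz iyz → u⊈t (spans (proj₁ (mem (x , z) ixz)) (proj₁ (mem (y , z) iyz)) (proj₂ (mem (x , z) ixz))))
         ∷ [])
      ∷ [] ∷ []
      where
      mem = involvesᶜ-members t
      spans : x ∈ members t → y ∈ members t → z ∈ members t → members (x , y , z) ⊆ members t
      spans x∈ y∈ z∈ = All.lookup (x∈ ∷ y∈ ∷ z∈ ∷ [])

  braid-inLT : {L L′ : Lottery n} → Braid L L′ → ∃ λ u → Unique (members u) × AgreesOutside L L′ u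
  braid-inLT (braidLR u v k) = braidLR-inLT u v k
  braid-inLT (braidRL u v k) with t₀ , t₀! , agree ← braidLR-inLT u v k =
    t₀ , t₀! , λ t t₀⊈t → sym (agree t t₀⊈t)

-- The size of the symmetric difference

xor-triangle : ∀ a b c → T (a xor c) → T (a xor b) ⊎ T (b xor c)
xor-triangle true true false _ = inj₂ _
xor-triangle true false _ _ = inj₁ _
xor-triangle false true _ _ = inj₁ _
xor-triangle false false true _ = inj₂ _

xor-≡ : ∀ {a b} → a ≡ b → ¬ T (a xor b)
xor-≡ {true} refl ()
xor-≡ {false} refl ()

module _ {n : ℕ} where

  open import Data.List.Relation.Binary.Subset.DecPropositional {A = Fin n} _≟_ using (_⊆?_)

  symDiffLT-triangle : (L₁ L₂ L₃ : Lottery n) → symDiffLT L₁ L₃ ≤ symDiffLT L₁ L₂ + symDiffLT L₂ L₃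
  symDiffLT-triangle L₁ L₂ L₃ =
    countᵇ-≤-+ (λ t → xor-triangle (inLT L₁ t) (inLT L₂ t) (inLT L₃ t)) (triples n)

  symDiffLT-≗ : (L L′ : Lottery n) → inLT L ≗ inLT L′ → symDiffLT L L′ ≡ 0
  symDiffLT-≗ L L′ agree = countᵇ-none (All.universal (λ t → xor-≡ (agree t)) (triples n))

  -- A sorted triple is determined by three distinct members, so at most one
  -- listed triple contains u.
  symDiffLT-≤1 : (L L′ : Lottery n) {u : Triple n} → Unique (members u) →
                 (∀ t → ¬ (members u ⊆ members t) → inLT L t ≡ inLT L′ t) → symDiffLT L L′ ≤ 1
  symDiffLT-≤1 L L′ {u} u! agree =
    countᵇ-≤1 (AllPairs-mapWithAll notBoth triples-sorted triples-unique)
    where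
    spans : ∀ t → T (inLT L t xor inLT L′ t) → members u ⊆ members t
    spans t differ with members u ⊆? members t
    ... | yes u⊆t = u⊆t
    ... | no u⊈t = contradiction differ (xor-≡ (agree t u⊈t))
    notBoth : ∀ {s s′} → Sorted s → Sorted s′ → s ≢ s′ →
              T (inLT L s xor inLT L′ s) → ¬ T (inLT L s′ xor inLT L′ s′)
    notBoth s↑ s′↑ s≢s′ ds ds′ = s≢s′ (sorted-≡-containing u! s↑ s′↑ (spans _ ds) (spans _ ds′))

module _ {m : ℕ} where

  braid-symDiffLT : {L L′ : Lottery (3 + m)} → Braid L L′ → symDiffLT L L′ ≤ 1
  braid-symDiffLT {L} {L′} braid with u , u! , agree ← braid-inLT braid = symDiffLT-≤1 L L′ u! agree

  symDiffLT-≤-braids : {k : ℕ} {L L′ : Lottery (3 + m)} → L ⟶[ k ] L′ → symDiffLT L L′ ≤ k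
  symDiffLT-≤-braids {L = L} done = ≤-reflexive (symDiffLT-≗ L L (λ _ → refl))
  symDiffLT-≤-braids {k} {L} {L″} (commS {L' = L′} commute steps) = begin
    symDiffLT L L″                    ≤⟨ symDiffLT-triangle L L′ L″ ⟩
    symDiffLT L L′ + symDiffLT L′ L″  ≡⟨ cong (_+ symDiffLT L′ L″) (symDiffLT-≗ L L′ (commute-inLT commute)) ⟩
    symDiffLT L′ L″                   ≤⟨ symDiffLT-≤-braids steps ⟩
    k                                 ∎
    where open ≤-Reasoning
  symDiffLT-≤-braids {L = L} {L″} (braidS {L' = L′} braid steps) =
    ≤-trans (symDiffLT-triangle L L′ L″) (+-mono-≤ (braid-symDiffLT braid) (symDiffLT-≤-braids steps))

-- The bound holds along any transformation.
lemma5 : ∀ (n : ℕ) (π : Permutation′ n) (y : Fin n → ℤ) → AlmostOptimal π y →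
         ∀ (L L' : Lottery n) → InL1y π y L → InL1y π y L' →
         ∀ (m : ℕ) → L ⟶[ m ] L' → symDiffLT L L' ≤ m
lemma5 (suc (suc (suc _))) _ _ _ _ _ _ _ _ steps = symDiffLT-≤-braids steps
lemma5 zero _ _ _ _ _ _ _ _ _ = z≤n
lemma5 (suc zero) _ _ _ _ _ _ _ _ _ = z≤n
lemma5 (suc (suc zero)) _ _ _ _ _ _ _ _ _ = z≤n
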